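{- Under the MMV-GST schedule in which every node prompted to transmit does transmit (regardless of packet content), the following holds: for any node $u$ with virtual-distance $d_u$, if some $G$-neighbor $v$ of $u$ has virtual-distance $d_v=d_u-1$, then during each interval of $6\lceil\log_2 n\rceil$ consecutive rounds, with probability at least $\frac18$, node $u$ receives a packet from a node with virtual-distance $d_u-1$.
   Context: Radio network model: a connected undirected graph $G$ with $n$ nodes and source $s$; synchronous rounds; a listening node receives a packet only if exactly one neighbor transmits. Let $\mathcal{T}$ be a GST of $G$ rooted at $s$: a BFS tree with levels $l_u=\mathrm{dist}_G(s,u)$ and ranks (leaves rank $1$; an internal node whose children have maximum rank $r$ gets rank $r$ if exactly one child has rank $r$, else $r+1$) such that whenever $u_1\neq u_2$ of rank $r$ at the same level have parents $v_1\neq v_2$ both of rank $r$, there is no $G$-edge $\{v_1,u_2\}$ or $\{v_2,u_1\}$. A fast stretch is a tree path from a node to a descendant with all nodes of equal rank; $u$ is the first node of a fast stretch if $u=s$ or its parent's rank differs from its own. The virtual directed graph $G'$ consists of both orientations of all $G$-edges plus a directed edge from each first node $u$ of a fast stretch of rank $r$ to each descendant of $u$ of rank $r$; $d_u$ is the directed distance from $s$ to $u$ in $G'$. MMV-GST schedule: in round $t$, node $u$ with level $l$, rank $r$, virtual-distance $d$ (a) transmits if $t\equiv 2(l+3r)\pmod{6\lceil\log_2 n\rceil}$; (b) if $t\equiv 1+2d\pmod 6$, transmits with probability $2^{ -\left(((t-1-2d)/6)\bmod\lceil\log_2 n\rceil\right)}$; otherwise listens. -}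

module Defs where

open import Data.Bool using (Bool; true; false; _∧_; _∨_; not; if_then_else_)
open import Data.Nat using (ℕ; zero; suc; _+_; _*_; _∸_; _≤_; _⊔_)
open import Data.Nat.Divisibility using (_∣_; _∣?_)
open import Data.Nat.Logarithm using (⌈log₂_⌉)
open import Data.Integer as ℤ using (ℤ; +_)
open import Data.Integer.DivMod using (_/ℕ_; _%ℕ_)
open import Data.Fin using (Fin; zero; suc; toℕ; combine)
open import Data.Fin.Properties using () renaming (_≟_ to _≟F_)
open import Data.List using (List; []; length; map; foldr)
open import Data.Bool.ListAction using (any; all)
open import Data.List.Base using (allFin; filterᵇ)
open import Data.Product using (Σ; ∃; _×_; _,_)
open import Data.Sum using (_⊎_)
open import Data.Rational as ℚ using (ℚ; 0ℚ; 1ℚ; ½)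
open import Relation.Nullary using (¬_; Dec; yes; no)
open import Relation.Nullary.Decidable using (⌊_⌋)
open import Relation.Binary.PropositionalEquality using (_≡_; _≢_)

record Graph (n : ℕ) : Set where
  field
    adj    : Fin n → Fin n → Bool
    adj-sym : ∀ u v → adj u v ≡ adj v u
    adj-irr : ∀ u → adj u u ≡ false
open Graph public

data Walk {n : ℕ} (R : Fin n → Fin n → Set) : Fin n → Fin n → ℕ → Set where
  here : ∀ {x} → Walk R x x 0
  step : ∀ {x y z k} → R x y → Walk R y z k → Walk R x z (suc k)

IsDist : {n : ℕ} → (Fin n → Fin n → Set) → Fin n → Fin n → ℕ → Set
IsDist R x y d = Walk R x y d × (∀ k → Walk R x y k → d ≤ k)

Edge : {n : ℕ} → Graph n → Fin n → Fin n → Set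
Edge G u v = adj G u v ≡ true

Connected : {n : ℕ} → Graph n → Set
Connected {n} G = ∀ (u v : Fin n) → ∃ λ k → Walk (Edge G) u v k

_==_ : {n : ℕ} → Fin n → Fin n → Bool
x == y = ⌊ x ≟F y ⌋

iter : {A : Set} → (A → A) → ℕ → A → A
iter f zero    x = x
iter f (suc k) x = f (iter f k x)

record RootedTree {n : ℕ} (G : Graph n) (s : Fin n) : Set where
  field
    parent      : Fin n → Fin n
    parent-root : parent s ≡ s
    parent-edge : ∀ u → u ≢ s → Edge G u (parent u)

  isChild : Fin n → Fin n → Bool
  isChild u v = not (u == s) ∧ (parent u == v)

  children : Fin n → List (Fin n)
  children v = filterᵇ (λ u → isChild u v) (allFin n)

  Desc : Fin n → Fin n → Set
  Desc v u = (u ≢ v) × (∃ λ k → iter parent k u ≡ v)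
open RootedTree public

module _ {n : ℕ} {G : Graph n} {s : Fin n} (T : RootedTree G s) where

  maxChildRank : (Fin n → ℕ) → Fin n → ℕ
  maxChildRank rank v = foldr _⊔_ 0 (map rank (children T v))

  countChildrenOfRank : (Fin n → ℕ) → Fin n → ℕ → ℕ
  countChildrenOfRank rank v r =
    length (filterᵇ (λ u → ⌊ Data.Nat._≟_ (rank u) r ⌋) (children T v))

  RankRule : (Fin n → ℕ) → Fin n → Set
  RankRule rank v =
    (children T v ≡ [] → rank v ≡ 1) ×
    (children T v ≢ [] →
      let r = maxChildRank rank v in
      (countChildrenOfRank rank v r ≡ 1 → rank v ≡ r) ×
      (countChildrenOfRank rank v r ≢ 1 → rank v ≡ suc r))

record GST {n : ℕ} (G : Graph n) (s : Fin n) : Set where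
  field
    tree      : RootedTree G s
    level     : Fin n → ℕ
    rank      : Fin n → ℕ
    level-dist : ∀ u → IsDist (Edge G) s u (level u)
    bfs       : ∀ u → u ≢ s → suc (level (parent tree u)) ≡ level u
    rank-rule : ∀ v → RankRule tree rank v
    gst-cond  : ∀ u₁ u₂ → u₁ ≢ s → u₂ ≢ s → u₁ ≢ u₂ →
                level u₁ ≡ level u₂ →
                rank u₁ ≡ rank u₂ →
                parent tree u₁ ≢ parent tree u₂ →
                rank (parent tree u₁) ≡ rank u₁ →
                rank (parent tree u₂) ≡ rank u₂ →
                (adj G (parent tree u₁) u₂ ≡ false) × (adj G (parent tree u₂) u₁ ≡ false)
open GST public

FirstNode : {n : ℕ} {G : Graph n} {s : Fin n} → GST G s → Fin n → Set
FirstNode {s = s} T u = (u ≡ s) ⊎ (rank T (parent (tree T) u) ≢ rank T u)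

VEdge : {n : ℕ} {G : Graph n} {s : Fin n} → GST G s → Fin n → Fin n → Set
VEdge {G = G} T x y =
  Edge G x y ⊎ (FirstNode T x × Desc (tree T) x y × rank T y ≡ rank T x)

-- a ≡ b (mod m) for naturals (m = 0 means equality)
congr? : ℕ → ℕ → ℕ → Bool
congr? m a b = ⌊ m ∣? (a ∸ b) ⌋ ∧ ⌊ m ∣? (b ∸ a) ⌋

-- integer residue q mod L in [0, L) (0 if L = 0; irrelevant case)
modL : ℤ → ℕ → ℕ
modL q zero    = 0
modL q (suc l) = q %ℕ suc l

half^ : ℕ → ℚ
half^ zero    = 1ℚ
half^ (suc k) = ½ ℚ.* half^ k

-- Finite product probability: ps i = Pr[coin i = true], coins independent;
-- Pr ps E = probability that the Bool-valued event E holds.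

Pr : (m : ℕ) → (Fin m → ℚ) → ((Fin m → Bool) → Bool) → ℚ
Pr zero    ps E = if E (λ ()) then 1ℚ else 0ℚ
Pr (suc m) ps E =
  ps zero ℚ.* Pr m (λ i → ps (suc i)) (λ f → E (λ { zero → true ; (suc i) → f i }))
  ℚ.+ (1ℚ ℚ.- ps zero) ℚ.* Pr m (λ i → ps (suc i)) (λ f → E (λ { zero → false ; (suc i) → f i }))

module Schedule {n : ℕ} (G : Graph n) {s : Fin n} (T : GST G s) (vd : Fin n → ℕ) where

  L : ℕ
  L = ⌈log₂ n ⌉

  detTx : ℕ → Fin n → Bool
  detTx t w = congr? (6 * L) t (2 * (level T w + 3 * rank T w))

  randRound : ℕ → Fin n → Bool
  randRound t w = congr? 6 t (1 + 2 * vd w)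

  expo : ℕ → Fin n → ℕ
  expo t w = modL ((+ t ℤ.- + (1 + 2 * vd w)) /ℕ 6) L

  coinProb : ℕ → Fin n → ℚ
  coinProb t w = if randRound t w then half^ (expo t w) else 0ℚ

  transmits : ℕ → Fin n → Bool → Bool
  transmits t w c = detTx t w ∨ (randRound t w ∧ c)

  receivesFrom : ℕ → (Fin n → Bool) → Fin n → Fin n → Bool
  receivesFrom t cs u w =
    not (transmits t u (cs u)) ∧ adj G u w ∧ transmits t w (cs w) ∧
    all (λ w' → (w' == w) ∨ not (adj G u w') ∨ not (transmits t w' (cs w'))) (allFin n)

  R : ℕ
  R = 6 * L

  -- event: during rounds t₀, …, t₀ + R - 1, u receives from some node of
  -- virtual distance vd u - 1 (coins indexed by (round offset, node))
  Success : Fin n → ℕ → (Fin (R * n) → Bool) → Bool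
  Success u t₀ ω =
    any (λ i → any (λ w →
          ⌊ Data.Nat._≟_ (suc (vd w)) (vd u) ⌋ ∧
          receivesFrom (t₀ + toℕ i) (λ x → ω (combine i x)) u w)
        (allFin n)) (allFin R)

  successProb : Fin n → ℕ → ℚ
  successProb u t₀ =
    Pr (R * n) (λ j → coinProbAt j) (Success u t₀)
    where
      coinProbAt : Fin (R * n) → ℚ
      coinProbAt j = coinProbFromPair (Data.Fin.remQuot n j)
        where
          coinProbFromPair : Fin R × Fin n → ℚ
          coinProbFromPair (i , w) = coinProb (t₀ + toℕ i) w

module Submission where

-- Let c be the number of neighbours of u at virtual distance d (the
-- senders); 1 ≤ c < n since v is one and u is not.  Choose k with
-- 2^k ≤ c < 2^(k+1); then k < L, and c coins of bias 2^-k show exactly one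
-- head with probability c 2^-k (1 - 2^-k)^(c-1) ≥ 1/8.  The window contains a
-- round t ≡ 1 + 2d + 6k (mod 6L).  In it nobody transmits by the deterministic
-- rule (t is odd), the senders transmit iff their coin shows heads, with bias
-- exactly 2^-k, and every other neighbour of u (at distance d + 1 or d + 2,
-- since G-edges are edges of G') and u itself stay silent.  So exactly one
-- sender coin showing heads in round t implies success, and monotonicity of
-- the product measure gives the bound.

open import Defs
open import Data.Bool using (Bool; true; false; _∧_; _∨_; not; if_then_else_)
open import Data.Bool.Properties using (T-≡; ¬-not)
open import Data.Bool.ListAction using (any; all)
open import Data.Nat as ℕ
  using (ℕ; zero; suc; _+_; _*_; _∸_; _^_; _≤_; _<_; z≤n; s≤s; NonZero; _≡ᵇ_; ⌊_/2⌋; ⌈_/2⌉)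
open import Data.Nat.Properties
open import Data.Nat.DivMod
  using (_%_; _/_; m≡m%n+[m/n]*n; m%n<n; [m+kn]%n≡m%n; m%n%n≡m%n; m∣n⇒o%n%m≡o%m; %-distribˡ-+; m*n%n≡0)
open import Data.Nat.Divisibility using (_∣_; divides; _∣?_; _∣0; ∣-trans)
open import Data.Nat.Logarithm using (⌈log₂_⌉; ⌈log₂⌉-mono-≤; ⌈log₂⌈n/2⌉⌉≡⌈log₂n⌉∸1)
open import Data.Nat.Solver using () renaming (module +-*-Solver to ℕ-Solver)
open import Data.Integer as ℤ using (ℤ; _/ℕ_; _%ℕ_) renaming (+_ to pos)
import Data.Integer.Properties as ℤP
open import Data.Integer.DivMod using (a≡a%ℕn+[a/ℕn]*n; n%ℕd<d)
open import Data.Integer.Solver using () renaming (module +-*-Solver to ℤ-Solver)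
open import Data.Rational as ℚ using (ℚ; 0ℚ; 1ℚ; ½)
import Data.Rational.Properties as ℚP
open import Data.Rational.Solver using () renaming (module +-*-Solver to ℚ-Solver)
open import Data.Fin using (Fin; zero; suc; toℕ; fromℕ<; combine; remQuot; _↑ˡ_; _↑ʳ_)
open import Data.Fin.Properties as FinP
  using (remQuot-combine; combine-remQuot; toℕ-fromℕ<; combine-injectiveʳ) renaming (_≟_ to _≟F_)
open import Data.List.Base using (allFin)
import Data.List.Relation.Unary.Any.Properties as Any
import Data.List.Relation.Unary.All.Properties as All
open import Data.Product using (∃; Σ; _×_; _,_; proj₁; proj₂)
open import Data.Sum as Sum using (_⊎_; inj₁; inj₂)
open import Data.Empty using (⊥-elim)
open import Data.Unit using (tt)
open import Function using (case_of_)
open import Function.Bundles using (Equivalence)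
open import Relation.Nullary using (Dec; yes; no; ¬_)
open import Relation.Nullary.Decidable using (⌊_⌋; isYes≗does; dec-true; toWitness; toWitnessFalse)
open import Relation.Binary.PropositionalEquality
open import Relation.Binary.Definitions using (tri<; tri≈; tri>)
open import Algebra.Bundles using (AbelianGroup)
open import Algebra.Properties.Group (AbelianGroup.group ℤP.+-0-abelianGroup) using (∙-cancelʳ)

count : ∀ m → (Fin m → Bool) → ℕ
count zero    h = 0
count (suc m) h = (if h zero then 1 else 0) + count m (λ i → h (suc i))

count-cong : ∀ m {h h' : Fin m → Bool} → (∀ i → h i ≡ h' i) → count m h ≡ count m h'
count-cong zero    e = refl
count-cong (suc m) e rewrite e zero = cong (_ +_) (count-cong m (λ i → e (suc i)))

count-none : ∀ m (h : Fin m → Bool) → (∀ i → h i ≡ false) → count m h ≡ 0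
count-none zero    h none = refl
count-none (suc m) h none rewrite none zero = count-none m _ (λ i → none (suc i))

count-zero : ∀ m (h : Fin m → Bool) → count m h ≡ 0 → ∀ i → h i ≡ false
count-zero (suc m) h c≡0 i with h zero in h0
count-zero (suc m) h c≡0 zero    | false = h0
count-zero (suc m) h c≡0 (suc i) | false = count-zero m _ c≡0 i

count-pos : ∀ m (h : Fin m → Bool) i → h i ≡ true → 1 ≤ count m h
count-pos (suc m) h zero    hi rewrite hi = s≤s z≤n
count-pos (suc m) h (suc i) hi with h zero
... | true  = s≤s z≤n
... | false = count-pos m _ i hi

count-≤ : ∀ m (h : Fin m → Bool) → count m h ≤ m
count-≤ zero    h = z≤n
count-≤ (suc m) h with h zero
... | true  = s≤s (count-≤ m _)
... | false = m≤n⇒m≤1+n (count-≤ m _)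

count-< : ∀ m (h : Fin m → Bool) i → h i ≡ false → count m h < m
count-< (suc m) h zero    hi rewrite hi = s≤s (count-≤ m _)
count-< (suc m) h (suc i) hi with h zero
... | true  = s≤s (count-< m _ i hi)
... | false = m≤n⇒m≤1+n (count-< m _ i hi)

count-one : ∀ m (h : Fin m → Bool) → count m h ≡ 1 →
            Σ (Fin m) λ j → h j ≡ true × (∀ j' → h j' ≡ true → j' ≡ j)
count-one (suc m) h c≡1 with h zero in h0
... | true  = zero , h0 , unique
  where
  unique : ∀ j' → h j' ≡ true → j' ≡ zero
  unique zero    _  = refl
  unique (suc i) hi with () ← trans (sym hi) (count-zero m _ (suc-injective c≡1) i)
... | false with count-one m (λ i → h (suc i)) c≡1
...   | j , hj , unique = suc j , hj , unique'
  where
  unique' : ∀ j' → h j' ≡ true → j' ≡ suc j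
  unique' zero    hz with () ← trans (sym hz) h0
  unique' (suc i) hi = cong suc (unique i hi)

count-++ : ∀ a b (h : Fin (a + b) → Bool) →
           count (a + b) h ≡ count a (λ x → h (x ↑ˡ b)) + count b (λ y → h (a ↑ʳ y))
count-++ zero    b h = refl
count-++ (suc a) b h = trans (cong (bit +_) (count-++ a b (λ i → h (suc i))))
                             (sym (+-assoc bit (count a (λ x → h (suc x ↑ˡ b))) (count b (λ y → h (suc a ↑ʳ y)))))
  where
  bit : ℕ
  bit = if h zero then 1 else 0

count-block : ∀ R n (h : Fin (R * n) → Bool) (i* : Fin R) →
              (∀ i x → i ≢ i* → h (combine i x) ≡ false) →
              count (R * n) h ≡ count n (λ x → h (combine i* x))
count-block (suc R) n h i* off = begin
  count (n + R * n) h
    ≡⟨ count-++ n (R * n) h ⟩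
  count n (λ x → h (combine {suc R} zero x)) + count (R * n) (λ y → h (n ↑ʳ y))
    ≡⟨ blocks i* off ⟩
  count n (λ x → h (combine {suc R} i* x)) ∎
  where
  open ≡-Reasoning
  later-blocks-off : (∀ i x → h (combine (suc i) x) ≡ false) → ∀ y → h (n ↑ʳ y) ≡ false
  later-blocks-off off' y =
    subst (λ z → h (n ↑ʳ z) ≡ false) (combine-remQuot {R} n y)
          (off' (proj₁ (remQuot {R} n y)) (proj₂ (remQuot {R} n y)))
  blocks : ∀ i* → (∀ i x → i ≢ i* → h (combine {suc R} i x) ≡ false) →
           count n (λ x → h (combine {suc R} zero x)) + count (R * n) (λ y → h (n ↑ʳ y))
           ≡ count n (λ x → h (combine {suc R} i* x))
  blocks zero off' =
    trans (cong (count n (λ x → h (combine {suc R} zero x)) +_)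
                (count-none (R * n) (λ y → h (n ↑ʳ y)) (later-blocks-off (λ i x → off' (suc i) x λ ()))))
          (+-identityʳ (count n (λ x → h (combine {suc R} zero x))))
  blocks (suc i*) off' =
    trans (cong (_+ count (R * n) (λ y → h (n ↑ʳ y))) (count-none n (λ x → h (combine {suc R} zero x)) (λ x → off' zero x λ ())))
          (count-block R n (λ y → h (n ↑ʳ y)) i* (λ i x i≢i* → off' (suc i) x (λ e → i≢i* (FinP.suc-injective e))))

heads : ∀ m → (Fin m → Bool) → (Fin m → Bool) → ℕ
heads m sel f = count m (λ i → sel i ∧ f i)

noneSelected : ∀ m → (Fin m → Bool) → (Fin m → Bool) → Bool
noneSelected m sel f = heads m sel f ≡ᵇ 0

oneSelected : ∀ m → (Fin m → Bool) → (Fin m → Bool) → Bool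
oneSelected m sel f = heads m sel f ≡ᵇ 1

-- their probabilities when every selected coin has bias p:  (1-p)^c  and,
-- by the same recursion as Pr,  oneHeadProb p c = c p (1-p)^(c-1)
pow : ℚ → ℕ → ℚ
pow q zero    = 1ℚ
pow q (suc c) = q ℚ.* pow q c

oneHeadProb : ℚ → ℕ → ℚ
oneHeadProb p zero    = 0ℚ
oneHeadProb p (suc c) = p ℚ.* pow (1ℚ ℚ.- p) c ℚ.+ (1ℚ ℚ.- p) ℚ.* oneHeadProb p c

Pr-never : ∀ m ps → Pr m ps (λ _ → false) ≡ 0ℚ
Pr-never zero    ps = refl
Pr-never (suc m) ps rewrite Pr-never m (λ i → ps (suc i)) =
  cong₂ ℚ._+_ (ℚP.*-zeroʳ (ps zero)) (ℚP.*-zeroʳ (1ℚ ℚ.- ps zero))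

mix-same : ∀ p x → p ℚ.* x ℚ.+ (1ℚ ℚ.- p) ℚ.* x ≡ x
mix-same p x = solve 2 (λ p x → p :* x :+ (con 1ℚ :- p) :* x := x) refl p x
  where open ℚ-Solver

-- the law of the number of selected heads, computed by conditioning on the
-- first coin; unselected coins average out
Pr-count : ∀ m (ps : Fin m → ℚ) (sel : Fin m → Bool) p → (∀ i → sel i ≡ true → ps i ≡ p) →
  (Pr m ps (noneSelected m sel) ≡ pow (1ℚ ℚ.- p) (count m sel)) ×
  (Pr m ps (oneSelected m sel) ≡ oneHeadProb p (count m sel))
Pr-count zero ps sel p h = refl , refl
Pr-count (suc m) ps sel p h with sel zero | h zero | Pr-count m (λ i → ps (suc i)) (λ i → sel (suc i)) p (λ i → h (suc i))
... | false | _ | none , one = trans (mix-same (ps zero) _) none , trans (mix-same (ps zero) _) one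
... | true | ps0 | none , one rewrite ps0 refl =
  trans (cong₂ ℚ._+_ (trans (cong (p ℚ.*_) (Pr-never m _)) (ℚP.*-zeroʳ p)) (cong ((1ℚ ℚ.- p) ℚ.*_) none))
        (ℚP.+-identityˡ _) ,
  cong₂ ℚ._+_ (cong (p ℚ.*_) none) (cong ((1ℚ ℚ.- p) ℚ.*_) one)

IsProb : ℚ → Set
IsProb p = 0ℚ ℚ.≤ p × p ℚ.≤ 1ℚ

Pr-mono : ∀ m (ps : Fin m → ℚ) → (∀ i → IsProb (ps i)) → (E E' : (Fin m → Bool) → Bool) →
          (∀ f → E f ≡ true → E' f ≡ true) → Pr m ps E ℚ.≤ Pr m ps E'
Pr-mono zero    ps probs E E' E⊆E' = indicator-mono _ _ (E⊆E' _)
  where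
  indicator-mono : ∀ b b' → (b ≡ true → b' ≡ true) → (if b then 1ℚ else 0ℚ) ℚ.≤ (if b' then 1ℚ else 0ℚ)
  indicator-mono false false _   = ℚP.≤-refl
  indicator-mono false true  _   = toWitness {a? = 0ℚ ℚP.≤? 1ℚ} tt
  indicator-mono true  b'    b⇒b' rewrite b⇒b' refl = ℚP.≤-refl
Pr-mono (suc m) ps probs E E' E⊆E' =
  ℚP.+-mono-≤ (ℚP.*-monoˡ-≤-nonNeg (ps zero) {{ℚ.nonNegative p≥0}} (Pr-mono m _ (λ i → probs (suc i)) _ _ (λ f → E⊆E' _)))
              (ℚP.*-monoˡ-≤-nonNeg (1ℚ ℚ.- ps zero) {{ℚ.nonNegative 1-p≥0}} (Pr-mono m _ (λ i → probs (suc i)) _ _ (λ f → E⊆E' _)))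
  where
  p≥0 : 0ℚ ℚ.≤ ps zero
  p≥0 = proj₁ (probs zero)
  1-p≥0 : 0ℚ ℚ.≤ 1ℚ ℚ.- ps zero
  1-p≥0 = ℚP.≤-trans (ℚP.≤-reflexive (sym (ℚP.+-inverseʳ 1ℚ))) (ℚP.+-monoʳ-≤ 1ℚ (ℚP.neg-antimono-≤ (proj₂ (probs zero))))

half^-prob : ∀ k → IsProb (half^ k)
half^-prob zero    = toWitness {a? = 0ℚ ℚP.≤? 1ℚ} tt , ℚP.≤-refl
half^-prob (suc k) with half^-prob k
... | 0≤h , h≤1 = ℚP.nonNegative⁻¹ _ {{ℚP.nonNeg*nonNeg⇒nonNeg ½ (half^ k) {{ℚ.nonNegative 0≤h}}}} ,
                  ℚP.≤-trans (ℚP.*-monoˡ-≤-nonNeg ½ h≤1) (toWitness {a? = ½ ℚ.* 1ℚ ℚP.≤? 1ℚ} tt)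

coin-prob : ∀ (b : Bool) k → IsProb (if b then half^ k else 0ℚ)
coin-prob true  k = half^-prob k
coin-prob false k = ℚP.≤-refl , ℚP.<⇒≤ (ℚP.positive⁻¹ 1ℚ)

-- With N = 2^(k+1) and M = N - 1 (so that
-- p = 1/N), the target inequality c p (1-p)^(c-1) ≥ 1/8 for N ≤ c ≤ 2N reads
-- N^c ≤ 8 c M^(c-1).  It holds at c = 2N because (1 + 1/M)^N ≤ 4, and it
-- propagates downwards because c ↦ c M^(c-1) / N^c decreases for c ≥ M.

mersenne : ℕ → ℕ
mersenne zero    = 1
mersenne (suc k) = suc (2 * mersenne k)

suc-mersenne : ∀ k → suc (mersenne k) ≡ 2 ^ suc k
suc-mersenne zero    = refl
suc-mersenne (suc k) = begin
  suc (suc (2 * mersenne k)) ≡⟨ sym (*-suc 2 (mersenne k)) ⟩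
  2 * suc (mersenne k)       ≡⟨ cong (2 *_) (suc-mersenne k) ⟩
  2 * 2 ^ suc k              ∎
  where open ≡-Reasoning

^-distribʳ-* : ∀ a b m → (a * b) ^ m ≡ a ^ m * b ^ m
^-distribʳ-* a b zero    = refl
^-distribʳ-* a b (suc m) rewrite ^-distribʳ-* a b m =
  solve 4 (λ a b x y → (a :* b) :* (x :* y) := (a :* x) :* (b :* y)) refl a b (a ^ m) (b ^ m)
  where open ℕ-Solver

doubling : ∀ A → suc A ^ suc A ≤ 4 * A ^ suc A →
           (2 * suc A) ^ (2 * suc A) ≤ 4 * suc (2 * A) ^ (2 * suc A)
doubling A ih = begin
  (2 * N) ^ (2 * N)              ≡⟨ sym (^-*-assoc (2 * N) 2 N) ⟩
  ((2 * N) ^ 2) ^ N              ≡⟨ cong (_^ N) (solve 1 (λ n → (con 2 :* n) :^ 2 := con 4 :* (n :* n)) refl N) ⟩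
  (4 * (N * N)) ^ N              ≡⟨ ^-distribʳ-* 4 (N * N) N ⟩
  4 ^ N * (N * N) ^ N            ≡⟨ cong (4 ^ N *_) (^-distribʳ-* N N N) ⟩
  4 ^ N * (N ^ N * N ^ N)        ≤⟨ *-monoʳ-≤ (4 ^ N) (*-monoʳ-≤ (N ^ N) ih) ⟩
  4 ^ N * (N ^ N * (4 * A ^ N))  ≡⟨ solve 3 (λ f n a → f :* (n :* (con 4 :* a)) := con 4 :* (f :* (a :* n))) refl (4 ^ N) (N ^ N) (A ^ N) ⟩
  4 * (4 ^ N * (A ^ N * N ^ N))  ≡⟨ cong (λ z → 4 * (4 ^ N * z)) (sym (^-distribʳ-* A N N)) ⟩
  4 * (4 ^ N * (A * N) ^ N)      ≡⟨ cong (4 *_) (sym (^-distribʳ-* 4 (A * N) N)) ⟩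
  4 * (4 * (A * N)) ^ N          ≤⟨ *-monoʳ-≤ 4 (^-monoˡ-≤ N am-gm) ⟩
  4 * (suc (2 * A) ^ 2) ^ N      ≡⟨ cong (4 *_) (^-*-assoc (suc (2 * A)) 2 N) ⟩
  4 * suc (2 * A) ^ (2 * N)      ∎
  where
  open ≤-Reasoning
  open ℕ-Solver
  N : ℕ
  N = suc A
  am-gm : 4 * (A * N) ≤ suc (2 * A) ^ 2
  am-gm = ≤-trans (m≤m+n (4 * (A * N)) 1)
    (≤-reflexive (solve 1 (λ a → con 4 :* (a :* (con 1 :+ a)) :+ con 1 := (con 1 :+ con 2 :* a) :^ 2) refl A))

mersenne-bound : ∀ k → suc (mersenne k) ^ suc (mersenne k) ≤ 4 * mersenne k ^ suc (mersenne k)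
mersenne-bound zero    = ≤-refl
mersenne-bound (suc k) =
  subst (λ N → N ^ N ≤ 4 * mersenne (suc k) ^ N) (*-suc 2 (mersenne k))
        (doubling (mersenne k) (mersenne-bound k))

-- N^c ≤ 8 c M^(c-1), where N = M + 1 and c = c' + 1:
-- the cross-multiplied form of  c (1/N) (1 - 1/N)^(c-1) ≥ 1/8
OneHeadBound : ℕ → ℕ → Set
OneHeadBound M c' = suc M ^ suc c' ≤ 8 * (suc c' * M ^ c')

endpoint : ∀ M → suc M ^ suc M ≤ 4 * M ^ suc M → OneHeadBound M (M + suc M)
endpoint M hK = begin
  N ^ (N + N)                                ≡⟨ ^-distribˡ-+-* N N N ⟩
  N ^ N * N ^ N                              ≤⟨ *-mono-≤ hK hK ⟩
  (4 * M ^ N) * (4 * M ^ N)                  ≡⟨ solve 2 (λ m x → (con 4 :* (m :* x)) :* (con 4 :* (m :* x)) := con 8 :* (con 2 :* m) :* (m :* x :* x)) refl M (M ^ M) ⟩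
  8 * (2 * M) * (M * M ^ M * M ^ M)             ≤⟨ *-monoˡ-≤ _ (*-monoʳ-≤ 8 (m≤n+m (2 * M) 2)) ⟩
  8 * (2 + 2 * M) * (M * M ^ M * M ^ M)      ≡⟨ solve 2 (λ m x → con 8 :* (con 2 :+ con 2 :* m) :* (m :* x :* x) := con 8 :* ((con 1 :+ (m :+ (con 1 :+ m))) :* (m :* (x :* x)))) refl M (M ^ M) ⟩
  8 * (suc (M + N) * (M * (M ^ M * M ^ M)))  ≡⟨ cong (λ z → 8 * (suc (M + N) * (M * z))) (sym (^-distribˡ-+-* M M M)) ⟩
  8 * (suc (M + N) * M ^ suc (M + M))        ≡⟨ cong (λ z → 8 * (suc (M + N) * M ^ z)) (sym (+-suc M M)) ⟩
  8 * (suc (M + N) * M ^ (M + N))            ∎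
  where
  open ≤-Reasoning
  open ℕ-Solver
  N : ℕ
  N = suc M

-- the bound at c + 1 gives the bound at c whenever M ≤ c, since
-- (c + 1) M ≤ c N there
step-down : ∀ M .{{_ : NonZero M}} c' → M ≤ suc c' → OneHeadBound M (suc c') → OneHeadBound M c'
step-down M c' M≤c hb = *-cancelʳ-≤ (N ^ c) (8 * (c * M ^ c')) (suc c * M) {{m*n≢0 (suc c) M}} (begin
  N ^ c * (suc c * M)          ≤⟨ *-monoʳ-≤ (N ^ c) ratio ⟩
  N ^ c * (c * N)              ≡⟨ solve 3 (λ x c n → x :* (c :* n) := c :* (n :* x)) refl (N ^ c) c N ⟩
  c * N ^ suc c                ≤⟨ *-monoʳ-≤ c hb ⟩
  c * (8 * (suc c * M ^ c))    ≡⟨ solve 3 (λ c m y → c :* (con 8 :* ((con 1 :+ c) :* (m :* y))) := con 8 :* (c :* y) :* ((con 1 :+ c) :* m)) refl c M (M ^ c') ⟩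
  8 * (c * M ^ c') * (suc c * M) ∎)
  where
  open ≤-Reasoning
  open ℕ-Solver
  N : ℕ
  N = suc M
  c : ℕ
  c = suc c'
  ratio : suc c * M ≤ c * N
  ratio = begin
    M + c * M  ≤⟨ +-monoˡ-≤ (c * M) M≤c ⟩
    c + c * M  ≡⟨ sym (*-suc c M) ⟩
    c * N      ∎

step-down* : ∀ M .{{_ : NonZero M}} c' j → M ≤ suc c' → OneHeadBound M (j + c') → OneHeadBound M c'
step-down* M c' zero    M≤c hb = hb
step-down* M c' (suc j) M≤c hb =
  step-down* M c' j M≤c (step-down M (j + c') (≤-trans M≤c (s≤s (m≤n+m c' j))) hb)

mersenne-nonZero : ∀ k → NonZero (mersenne k)
mersenne-nonZero zero    = _
mersenne-nonZero (suc k) = _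

mersenne-window : ∀ k c' → mersenne k ≤ c' → c' ≤ mersenne k + suc (mersenne k) →
                  OneHeadBound (mersenne k) c'
mersenne-window k c' lo hi =
  step-down* M {{mersenne-nonZero k}} c' j (m≤n⇒m≤1+n lo)
    (subst (OneHeadBound M) (sym (m∸n+n≡m hi)) (endpoint M (mersenne-bound k)))
  where
  M : ℕ
  M = mersenne k
  j : ℕ
  j = M + suc M ∸ c'

n<2^n : ∀ n → n < 2 ^ n
n<2^n zero    = s≤s z≤n
n<2^n (suc n) = begin-strict
  suc n          <⟨ s≤s (n<2^n n) ⟩
  suc (2 ^ n)    ≤⟨ +-monoˡ-≤ (2 ^ n) (m^n>0 2 n) ⟩
  2 ^ n + 2 ^ n  ≡⟨ cong (2 ^ n +_) (sym (+-identityʳ (2 ^ n))) ⟩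
  2 ^ suc n      ∎
  where open ≤-Reasoning

dyadic-interval : ∀ c → 1 ≤ c → ∃ λ e → 2 ^ e ≤ c × c < 2 ^ suc e
dyadic-interval c 1≤c = search c (n<2^n c)
  where
  search : ∀ B → c < 2 ^ B → ∃ λ e → 2 ^ e ≤ c × c < 2 ^ suc e
  search zero    c<1 = ⊥-elim (<⇒≱ c<1 1≤c)
  search (suc B) c<2^B+1 with c <? 2 ^ B
  ... | yes c<2^B = search B c<2^B
  ... | no  c≮2^B = B , ≮⇒≥ c≮2^B , c<2^B+1

-- ⌈log₂ (2^e + 1)⌉ = e + 1, so 2^e < n forces e < ⌈log₂ n⌉
⌈log₂⌉-above-power : ∀ e → suc e ≤ ⌈log₂ (suc (2 ^ e)) ⌉
⌈log₂⌉-above-power zero    = ≤-refl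
⌈log₂⌉-above-power (suc e) = unshift (begin
  suc e                                  ≤⟨ ⌈log₂⌉-above-power e ⟩
  ⌈log₂ (suc (2 ^ e)) ⌉                  ≡⟨ cong ⌈log₂_⌉ (sym halve) ⟩
  ⌈log₂ ⌈ suc (2 ^ suc e) /2⌉ ⌉          ≡⟨ ⌈log₂⌈n/2⌉⌉≡⌈log₂n⌉∸1 (suc (2 ^ suc e)) ⟩
  ⌈log₂ (suc (2 ^ suc e)) ⌉ ∸ 1          ∎)
  where
  open ≤-Reasoning
  ⌊m+m/2⌋≡m : ∀ m → ⌊ m + m /2⌋ ≡ m
  ⌊m+m/2⌋≡m zero    = refl
  ⌊m+m/2⌋≡m (suc m) = trans (cong (λ z → ⌊ suc z /2⌋) (+-suc m m)) (cong suc (⌊m+m/2⌋≡m m))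
  halve : ⌈ suc (2 ^ suc e) /2⌉ ≡ suc (2 ^ e)
  halve = cong suc (trans (cong (λ z → ⌊ 2 ^ e + z /2⌋) (+-identityʳ (2 ^ e))) (⌊m+m/2⌋≡m (2 ^ e)))
  unshift : ∀ {X} → suc e ≤ X ∸ 1 → suc (suc e) ≤ X
  unshift {suc X} le = s≤s le

<⌈log₂⌉ : ∀ e n → 2 ^ e < n → e < ⌈log₂ n ⌉
<⌈log₂⌉ e n 2^e<n = ≤-trans (⌈log₂⌉-above-power e) (⌈log₂⌉-mono-≤ 2^e<n)

ι : ℕ → ℚ
ι zero    = 0ℚ
ι (suc n) = 1ℚ ℚ.+ ι n

ι-+ : ∀ a b → ι (a + b) ≡ ι a ℚ.+ ι b
ι-+ zero    b = sym (ℚP.+-identityˡ (ι b))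
ι-+ (suc a) b = trans (cong (1ℚ ℚ.+_) (ι-+ a b)) (sym (ℚP.+-assoc 1ℚ (ι a) (ι b)))

ι-* : ∀ a b → ι (a * b) ≡ ι a ℚ.* ι b
ι-* zero    b = sym (ℚP.*-zeroˡ (ι b))
ι-* (suc a) b = begin
  ι (b + a * b)                ≡⟨ ι-+ b (a * b) ⟩
  ι b ℚ.+ ι (a * b)            ≡⟨ cong (ι b ℚ.+_) (ι-* a b) ⟩
  ι b ℚ.+ ι a ℚ.* ι b          ≡⟨ solve 2 (λ x y → x :+ y :* x := (con 1ℚ :+ y) :* x) refl (ι b) (ι a) ⟩
  (1ℚ ℚ.+ ι a) ℚ.* ι b         ∎
  where open ≡-Reasoning
        open ℚ-Solver

ι-mono : ∀ {a b} → a ≤ b → ι a ℚ.≤ ι b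
ι-mono {b = b} z≤n = nonneg b
  where
  nonneg : ∀ a → 0ℚ ℚ.≤ ι a
  nonneg zero    = ℚP.≤-refl
  nonneg (suc a) = ℚP.+-mono-≤ (toWitness {a? = 0ℚ ℚP.≤? 1ℚ} tt) (nonneg a)
ι-mono (s≤s a≤b) = ℚP.+-monoʳ-≤ 1ℚ (ι-mono a≤b)

ι-pos : ∀ a → 0ℚ ℚ.< ι (suc a)
ι-pos a = ℚP.<-≤-trans (toWitness {a? = 0ℚ ℚP.<? 1ℚ} tt) (ι-mono (s≤s (z≤n {a})))

half^-inverse : ∀ k → half^ k ℚ.* ι (2 ^ k) ≡ 1ℚ
half^-inverse zero    = refl
half^-inverse (suc k) = begin
  (½ ℚ.* half^ k) ℚ.* ι (2 * 2 ^ k)          ≡⟨ cong ((½ ℚ.* half^ k) ℚ.*_) (ι-* 2 (2 ^ k)) ⟩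
  (½ ℚ.* half^ k) ℚ.* (ι 2 ℚ.* ι (2 ^ k))    ≡⟨ solve 4 (λ a b c d → (a :* b) :* (c :* d) := (a :* c) :* (b :* d)) refl ½ (half^ k) (ι 2) (ι (2 ^ k)) ⟩
  (½ ℚ.* ι 2) ℚ.* (half^ k ℚ.* ι (2 ^ k))    ≡⟨ cong ((½ ℚ.* ι 2) ℚ.*_) (half^-inverse k) ⟩
  1ℚ                                         ∎
  where open ≡-Reasoning
        open ℚ-Solver

-- With p = 1/N and N = M + 1, clearing denominators turns the closed forms
-- (1-p)^c and c p (1-p)^(c-1) into M^c and c M^(c-1).
module Scaled (M : ℕ) (p : ℚ) (p*N≡1 : p ℚ.* ι (suc M) ≡ 1ℚ) where
  open ℚ-Solver
  open ≡-Reasoning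

  q : ℚ
  q = 1ℚ ℚ.- p

  q*N≡M : q ℚ.* ι (suc M) ≡ ι M
  q*N≡M = begin
    (1ℚ ℚ.- p) ℚ.* ι (suc M)        ≡⟨ solve 2 (λ p x → (con 1ℚ :- p) :* x := x :- p :* x) refl p (ι (suc M)) ⟩
    ι (suc M) ℚ.- p ℚ.* ι (suc M)   ≡⟨ cong (λ z → ι (suc M) ℚ.- z) p*N≡1 ⟩
    (1ℚ ℚ.+ ι M) ℚ.- 1ℚ             ≡⟨ solve 1 (λ x → (con 1ℚ :+ x) :- con 1ℚ := x) refl (ι M) ⟩
    ι M                             ∎

  regroup : ∀ a b x y → (a ℚ.* b) ℚ.* (x ℚ.* y) ≡ (a ℚ.* x) ℚ.* (b ℚ.* y)
  regroup = solve 4 (λ a b x y → (a :* b) :* (x :* y) := (a :* x) :* (b :* y)) refl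

  pow-scaled : ∀ c → pow q c ℚ.* ι (suc M ^ c) ≡ ι (M ^ c)
  pow-scaled zero    = refl
  pow-scaled (suc c) = begin
    (q ℚ.* pow q c) ℚ.* ι (suc M * suc M ^ c)            ≡⟨ cong ((q ℚ.* pow q c) ℚ.*_) (ι-* (suc M) (suc M ^ c)) ⟩
    (q ℚ.* pow q c) ℚ.* (ι (suc M) ℚ.* ι (suc M ^ c))    ≡⟨ regroup q (pow q c) (ι (suc M)) (ι (suc M ^ c)) ⟩
    (q ℚ.* ι (suc M)) ℚ.* (pow q c ℚ.* ι (suc M ^ c))    ≡⟨ cong₂ ℚ._*_ q*N≡M (pow-scaled c) ⟩
    ι M ℚ.* ι (M ^ c)                                    ≡⟨ sym (ι-* M (M ^ c)) ⟩
    ι (M ^ suc c)                                        ∎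

  -- the recursion of oneHeadProb, on the ℕ side
  one-head-recursion : ∀ c → M ^ c + M * (c * M ^ (c ∸ 1)) ≡ suc c * M ^ c
  one-head-recursion zero    = cong (1 +_) (*-zeroʳ M)
  one-head-recursion (suc c) = S.solve 3 (λ m c x → m S.:* x S.:+ m S.:* ((S.con 1 S.:+ c) S.:* x) S.:= (S.con 2 S.:+ c) S.:* (m S.:* x)) refl M c (M ^ c)
    where module S = ℕ-Solver

  oneHead-scaled : ∀ c → oneHeadProb p c ℚ.* ι (suc M ^ c) ≡ ι (c * M ^ (c ∸ 1))
  oneHead-scaled zero    = refl
  oneHead-scaled (suc c) = begin
    (p ℚ.* pow q c ℚ.+ q ℚ.* oneHeadProb p c) ℚ.* ι (suc M * suc M ^ c)
      ≡⟨ cong ((p ℚ.* pow q c ℚ.+ q ℚ.* oneHeadProb p c) ℚ.*_) (ι-* (suc M) (suc M ^ c)) ⟩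
    (p ℚ.* pow q c ℚ.+ q ℚ.* oneHeadProb p c) ℚ.* (N ℚ.* Y)
      ≡⟨ solve 6 (λ p q P O X Y → (p :* P :+ q :* O) :* (X :* Y) := (p :* X) :* (P :* Y) :+ (q :* X) :* (O :* Y)) refl p q (pow q c) (oneHeadProb p c) N Y ⟩
    (p ℚ.* N) ℚ.* (pow q c ℚ.* Y) ℚ.+ (q ℚ.* N) ℚ.* (oneHeadProb p c ℚ.* Y)
      ≡⟨ cong₂ (λ a b → a ℚ.* (pow q c ℚ.* Y) ℚ.+ b ℚ.* (oneHeadProb p c ℚ.* Y)) p*N≡1 q*N≡M ⟩
    1ℚ ℚ.* (pow q c ℚ.* Y) ℚ.+ ι M ℚ.* (oneHeadProb p c ℚ.* Y)
      ≡⟨ cong₂ (λ a b → 1ℚ ℚ.* a ℚ.+ ι M ℚ.* b) (pow-scaled c) (oneHead-scaled c) ⟩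
    1ℚ ℚ.* ι (M ^ c) ℚ.+ ι M ℚ.* ι (c * M ^ (c ∸ 1))
      ≡⟨ cong₂ ℚ._+_ (ℚP.*-identityˡ (ι (M ^ c))) (sym (ι-* M (c * M ^ (c ∸ 1)))) ⟩
    ι (M ^ c) ℚ.+ ι (M * (c * M ^ (c ∸ 1)))
      ≡⟨ sym (ι-+ (M ^ c) _) ⟩
    ι (M ^ c + M * (c * M ^ (c ∸ 1)))
      ≡⟨ cong ι (one-head-recursion c) ⟩
    ι (suc c * M ^ c) ∎
    where
    N : ℚ
    N = ι (suc M)
    Y : ℚ
    Y = ι (suc M ^ c)

oneHead-dyadic : ∀ e c → 2 ^ e ≤ c → c < 2 ^ suc e → half^ 3 ℚ.≤ oneHeadProb (half^ e) c
oneHead-dyadic zero    (suc zero)    _  _                  = toWitness {a? = half^ 3 ℚP.≤? oneHeadProb 1ℚ 1} tt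
oneHead-dyadic zero    (suc (suc c)) _  (s≤s (s≤s ()))
oneHead-dyadic (suc k) zero          lo _                  = ⊥-elim (<⇒≱ (m^n>0 2 (suc k)) lo)
oneHead-dyadic (suc k) (suc c')      lo hi                 =
  ℚP.*-cancelʳ-≤-pos Y {{ℚ.positive Y-pos}} (begin
    half^ 3 ℚ.* Y               ≤⟨ ℚP.*-monoˡ-≤-nonNeg (half^ 3) (ι-mono cross-multiplied) ⟩
    half^ 3 ℚ.* ι (8 * X)       ≡⟨ cong (half^ 3 ℚ.*_) (ι-* 8 X) ⟩
    half^ 3 ℚ.* (ι 8 ℚ.* ι X)   ≡⟨ sym (ℚP.*-assoc (half^ 3) (ι 8) (ι X)) ⟩
    (half^ 3 ℚ.* ι 8) ℚ.* ι X   ≡⟨ ℚP.*-identityˡ (ι X) ⟩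
    ι X                         ≡⟨ sym (Scaled.oneHead-scaled M p p*N≡1 (suc c')) ⟩
    oneHeadProb p (suc c') ℚ.* Y ∎)
  where
  open ℚP.≤-Reasoning
  M : ℕ
  M = mersenne k
  p : ℚ
  p = half^ (suc k)
  X : ℕ
  X = suc c' * M ^ c'
  Y : ℚ
  Y = ι (suc M ^ suc c')
  p*N≡1 : p ℚ.* ι (suc M) ≡ 1ℚ
  p*N≡1 = subst (λ z → p ℚ.* ι z ≡ 1ℚ) (sym (suc-mersenne k)) (half^-inverse (suc k))
  Y-pos : 0ℚ ℚ.< Y
  Y-pos = ℚP.<-≤-trans (ι-pos 0) (ι-mono (m^n>0 (suc M) (suc c')))
  2^k+2≡ : 2 ^ suc (suc k) ≡ suc (suc (M + M))
  2^k+2≡ = trans (cong (2 *_) (sym (suc-mersenne k)))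
                 (NS.solve 1 (λ m → NS.con 2 NS.:* (NS.con 1 NS.:+ m) NS.:= NS.con 2 NS.:+ (m NS.:+ m)) refl M)
    where module NS = ℕ-Solver
  c'-lo : M ≤ c'
  c'-lo = ≤-pred (subst (_≤ suc c') (sym (suc-mersenne k)) lo)
  c'-hi : c' ≤ M + suc M
  c'-hi = ≤-trans (≤-pred (≤-pred (≤-trans hi (≤-reflexive 2^k+2≡))))
                     (+-monoʳ-≤ M (n≤1+n M))
  cross-multiplied : suc M ^ suc c' ≤ 8 * X
  cross-multiplied = mersenne-window k c' c'-lo c'-hi

-- choosing k = ⌊log₂ c⌋, which is below ⌈log₂ n⌉ whenever c < n
oneHead-choice : ∀ n c → 1 ≤ c → c < n →
                 ∃ λ k → k < ⌈log₂ n ⌉ × half^ 3 ℚ.≤ oneHeadProb (half^ k) c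
oneHead-choice n c 1≤c c<n with dyadic-interval c 1≤c
... | e , lo , hi = e , <⌈log₂⌉ e n (≤-<-trans lo c<n) , oneHead-dyadic e c lo hi

⌊⌋-true : ∀ {P : Set} (d : Dec P) → P → ⌊ d ⌋ ≡ true
⌊⌋-true d p = trans (isYes≗does d) (dec-true d p)

⌊⌋-sound : ∀ {P : Set} (d : Dec P) → ⌊ d ⌋ ≡ true → P
⌊⌋-sound d h = toWitness (Equivalence.from T-≡ h)

module _ (m : ℕ) .{{_ : NonZero m}} where

  %≡⇒∣∸ : ∀ a b → a ≤ b → a % m ≡ b % m → m ∣ b ∸ a
  %≡⇒∣∸ a b a≤b eq = divides (b / m ∸ a / m) (begin
    b ∸ a                                        ≡⟨ cong₂ _∸_ (m≡m%n+[m/n]*n b m) (m≡m%n+[m/n]*n a m) ⟩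
    (b % m + b / m * m) ∸ (a % m + a / m * m)    ≡⟨ cong (λ z → (b % m + b / m * m) ∸ (z + a / m * m)) eq ⟩
    (b % m + b / m * m) ∸ (b % m + a / m * m)    ≡⟨ [m+n]∸[m+o]≡n∸o (b % m) _ _ ⟩
    b / m * m ∸ a / m * m                        ≡⟨ sym (*-distribʳ-∸ m (b / m) (a / m)) ⟩
    (b / m ∸ a / m) * m                          ∎)
    where open ≡-Reasoning

  ∣∸⇒%≡ : ∀ a b → a ≤ b → m ∣ b ∸ a → a % m ≡ b % m
  ∣∸⇒%≡ a b a≤b (divides q b∸a≡q*m) = sym (begin
    b % m                ≡⟨ cong (_% m) (sym (m+[n∸m]≡n a≤b)) ⟩
    (a + (b ∸ a)) % m    ≡⟨ cong (λ z → (a + z) % m) b∸a≡q*m ⟩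
    (a + q * m) % m      ≡⟨ [m+kn]%n≡m%n a q m ⟩
    a % m                ∎)
    where open ≡-Reasoning

  congr?-complete : ∀ a b → a % m ≡ b % m → congr? m a b ≡ true
  congr?-complete a b eq with ≤-total a b
  ... | inj₁ a≤b rewrite m≤n⇒m∸n≡0 a≤b =
    cong₂ _∧_ (⌊⌋-true (m ∣? 0) (m ∣0)) (⌊⌋-true (m ∣? (b ∸ a)) (%≡⇒∣∸ a b a≤b eq))
  ... | inj₂ b≤a rewrite m≤n⇒m∸n≡0 b≤a =
    cong₂ _∧_ (⌊⌋-true (m ∣? (a ∸ b)) (%≡⇒∣∸ b a b≤a (sym eq))) (⌊⌋-true (m ∣? 0) (m ∣0))

  congr?-sound : ∀ a b → congr? m a b ≡ true → a % m ≡ b % m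
  congr?-sound a b h with ⌊ m ∣? (a ∸ b) ⌋ in d₁ | ⌊ m ∣? (b ∸ a) ⌋ in d₂ | ≤-total a b
  ... | true | true | inj₁ a≤b = ∣∸⇒%≡ a b a≤b (⌊⌋-sound (m ∣? (b ∸ a)) d₂)
  ... | true | true | inj₂ b≤a = sym (∣∸⇒%≡ b a b≤a (⌊⌋-sound (m ∣? (a ∸ b)) d₁))

%-coarsen : ∀ m n {a b} .{{_ : NonZero m}} .{{_ : NonZero n}} → m ∣ n → a % n ≡ b % n → a % m ≡ b % m
%-coarsen m n {a} {b} m∣n eq = begin
  a % m        ≡⟨ sym (m∣n⇒o%n%m≡o%m m n a m∣n) ⟩
  a % n % m    ≡⟨ cong (_% m) eq ⟩
  b % n % m    ≡⟨ m∣n⇒o%n%m≡o%m m n b m∣n ⟩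
  b % m        ∎
  where open ≡-Reasoning

congr?-shift : ∀ m .{{_ : NonZero m}} t a s → t % m ≡ a % m → ¬ (m ∣ s) → congr? m t (a + s) ≡ false
congr?-shift m t a s t≡a m∤s = ¬-not λ h → m∤s (subst (m ∣_) (m+n∸m≡n a s)
  (%≡⇒∣∸ m a (a + s) (m≤m+n a s) (trans (sym t≡a) (congr?-sound m t (a + s) h))))

-- a round ≡ 1 + 2d (mod 6) is odd, so it is never ≡ 2e modulo the even number 6L
parity-clash : ∀ L' t d e → t % 6 ≡ (1 + 2 * d) % 6 → congr? (6 * suc L') t (2 * e) ≡ false
parity-clash L' t d e t≡ = ¬-not λ h → 1+n≢0 (begin
  1                  ≡⟨ sym ([m+kn]%n≡m%n 1 d 2) ⟩
  (1 + d * 2) % 2    ≡⟨ cong (λ z → (1 + z) % 2) (*-comm d 2) ⟩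
  (1 + 2 * d) % 2    ≡⟨ %-coarsen 2 6 {1 + 2 * d} {t} (divides 3 refl) (sym t≡) ⟩
  t % 2              ≡⟨ %-coarsen 2 (6 * suc L') {t} {2 * e} (∣-trans (divides 3 refl) (divides (suc L') (*-comm 6 (suc L')))) (congr?-sound (6 * suc L') t (2 * e) h) ⟩
  (2 * e) % 2        ≡⟨ cong (_% 2) (*-comm 2 e) ⟩
  (e * 2) % 2        ≡⟨ m*n%n≡0 e 2 ⟩
  0                  ∎)
  where open ≡-Reasoning

residue-in-window : ∀ M .{{_ : NonZero M}} t₀ r → ∃ λ i → i < M × (t₀ + i) % M ≡ r % M
residue-in-window M t₀ r = x % M , m%n<n x M , (begin
  (t₀ + x % M) % M               ≡⟨ %-distribˡ-+ t₀ (x % M) M ⟩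
  (t₀ % M + x % M % M) % M       ≡⟨ cong (λ z → (t₀ % M + z) % M) (m%n%n≡m%n x M) ⟩
  (t₀ % M + x % M) % M           ≡⟨ sym (%-distribˡ-+ t₀ x M) ⟩
  (t₀ + x) % M                   ≡⟨ cong (_% M) wrap ⟩
  (r + t₀ * M) % M               ≡⟨ [m+kn]%n≡m%n r t₀ M ⟩
  r % M                          ∎)
  where
  open ≡-Reasoning
  x : ℕ
  x = r + (t₀ * M ∸ t₀)
  wrap : t₀ + x ≡ r + t₀ * M
  wrap = begin
    t₀ + (r + (t₀ * M ∸ t₀))    ≡⟨ +-comm t₀ _ ⟩
    r + (t₀ * M ∸ t₀) + t₀      ≡⟨ +-assoc r _ t₀ ⟩
    r + ((t₀ * M ∸ t₀) + t₀)    ≡⟨ cong (r +_) (m∸n+n≡m (m≤m*n t₀ M)) ⟩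
    r + t₀ * M                  ∎

smaller-quotient : ∀ d r r' {q q'} → r < d → q ℤ.< q' →
                   pos r ℤ.+ q ℤ.* pos d ℤ.< pos r' ℤ.+ q' ℤ.* pos d
smaller-quotient d r r' {q} {q'} r<d q<q' = ℤP.<-≤-trans (ℤP.+-monoˡ-< (q ℤ.* pos d) (ℤ.+<+ r<d)) (begin
  pos d ℤ.+ q ℤ.* pos d      ≡⟨ cong (ℤ._+ q ℤ.* pos d) (sym (ℤP.*-identityˡ (pos d))) ⟩
  ℤ.1ℤ ℤ.* pos d ℤ.+ q ℤ.* pos d ≡⟨ sym (ℤP.*-distribʳ-+ (pos d) ℤ.1ℤ q) ⟩
  ℤ.suc q ℤ.* pos d          ≤⟨ ℤP.*-monoʳ-≤-nonNeg (pos d) (ℤP.i<j⇒suc[i]≤j q<q') ⟩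
  q' ℤ.* pos d               ≤⟨ ℤP.i≤j+i (q' ℤ.* pos d) (pos r') ⟩
  pos r' ℤ.+ q' ℤ.* pos d    ∎)
  where open ℤP.≤-Reasoning

divmod-unique : ∀ x d .{{_ : NonZero d}} r q → r < d → x ≡ pos r ℤ.+ q ℤ.* pos d →
                x /ℕ d ≡ q × x %ℕ d ≡ r
divmod-unique x d r q r<d x≡ with ℤP.<-cmp q (x /ℕ d)
... | tri< q<q' _ _ = ⊥-elim (ℤP.<-irrefl (trans (sym x≡) (a≡a%ℕn+[a/ℕn]*n x d))
                                           (smaller-quotient d r (x %ℕ d) r<d q<q'))
... | tri> _ _ q'<q = ⊥-elim (ℤP.<-irrefl (trans (sym (a≡a%ℕn+[a/ℕn]*n x d)) x≡)
                                           (smaller-quotient d (x %ℕ d) r (n%ℕd<d x d) q'<q))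
... | tri≈ _ q≡q' _ = sym q≡q' , ℤP.+-injective (∙-cancelʳ (q ℤ.* pos d) _ _ (begin
      pos (x %ℕ d) ℤ.+ q ℤ.* pos d           ≡⟨ cong (λ z → pos (x %ℕ d) ℤ.+ z ℤ.* pos d) q≡q' ⟩
      pos (x %ℕ d) ℤ.+ (x /ℕ d) ℤ.* pos d    ≡⟨ sym (a≡a%ℕn+[a/ℕn]*n x d) ⟩
      x                                      ≡⟨ x≡ ⟩
      pos r ℤ.+ q ℤ.* pos d                  ∎))
  where open ≡-Reasoning

pos-divmod : ∀ m n .{{_ : NonZero n}} → pos m ≡ pos (m % n) ℤ.+ pos (m / n) ℤ.* pos n
pos-divmod m n = begin
  pos m                                   ≡⟨ cong pos (m≡m%n+[m/n]*n m n) ⟩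
  pos (m % n + m / n * n)                 ≡⟨ ℤP.pos-+ (m % n) (m / n * n) ⟩
  pos (m % n) ℤ.+ pos (m / n * n)         ≡⟨ cong (λ z → pos (m % n) ℤ.+ z) (ℤP.pos-* (m / n) n) ⟩
  pos (m % n) ℤ.+ pos (m / n) ℤ.* pos n   ∎
  where open ≡-Reasoning

module TargetRound (L' t a k : ℕ) (t≡ : t % (6 * suc L') ≡ (a + 6 * k) % (6 * suc L')) where
  private
    L : ℕ
    L = suc L'
    N : ℕ
    N = 6 * L

  target-mod-6 : t % 6 ≡ a % 6
  target-mod-6 = begin
    t % 6                ≡⟨ %-coarsen 6 N {t} {a + 6 * k} (divides L (*-comm 6 L)) t≡ ⟩
    (a + 6 * k) % 6      ≡⟨ cong (λ z → (a + z) % 6) (*-comm 6 k) ⟩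
    (a + k * 6) % 6      ≡⟨ [m+kn]%n≡m%n a k 6 ⟩
    a % 6                ∎
    where open ≡-Reasoning

  target-exponent : k < L → modL ((pos t ℤ.- pos a) /ℕ 6) L ≡ k
  target-exponent k<L = begin
    (pos t ℤ.- pos a) /ℕ 6 %ℕ L   ≡⟨ cong (_%ℕ L) (proj₁ (divmod-unique _ 6 0 Q (s≤s z≤n) t-a≡)) ⟩
    Q %ℕ L                         ≡⟨ proj₂ (divmod-unique Q L k (Q₁ ℤ.- Q₂) k<L refl) ⟩
    k                              ∎
    where
    open ≡-Reasoning
    open ℤ-Solver
    Q₁ : ℤ
    Q₁ = pos (t / N)
    Q₂ : ℤ
    Q₂ = pos ((a + 6 * k) / N)
    Q : ℤ
    Q = pos k ℤ.+ (Q₁ ℤ.- Q₂) ℤ.* pos L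
    ρ : ℤ
    ρ = pos (t % N)
    +N≡ : pos N ≡ pos 6 ℤ.* pos L
    +N≡ = ℤP.pos-* 6 L
    shifted : pos a ℤ.+ pos 6 ℤ.* pos k ≡ ρ ℤ.+ Q₂ ℤ.* pos N
    shifted = begin
      pos a ℤ.+ pos 6 ℤ.* pos k   ≡⟨ cong (λ z → pos a ℤ.+ z) (sym (ℤP.pos-* 6 k)) ⟩
      pos a ℤ.+ pos (6 * k)       ≡⟨ sym (ℤP.pos-+ a (6 * k)) ⟩
      pos (a + 6 * k)             ≡⟨ pos-divmod (a + 6 * k) N ⟩
      _                           ≡⟨ cong (λ r → pos r ℤ.+ Q₂ ℤ.* pos N) (sym t≡) ⟩
      ρ ℤ.+ Q₂ ℤ.* pos N          ∎
    t-a≡ : pos t ℤ.- pos a ≡ pos 0 ℤ.+ Q ℤ.* pos 6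
    t-a≡ = begin
      pos t ℤ.- pos a
        ≡⟨ solve 3 (λ t a k → t :- a := t :- (a :+ con (pos 6) :* k) :+ con (pos 6) :* k) refl (pos t) (pos a) (pos k) ⟩
      pos t ℤ.- (pos a ℤ.+ pos 6 ℤ.* pos k) ℤ.+ pos 6 ℤ.* pos k
        ≡⟨ cong₂ (λ x y → x ℤ.- y ℤ.+ pos 6 ℤ.* pos k) (pos-divmod t N) shifted ⟩
      (ρ ℤ.+ Q₁ ℤ.* pos N) ℤ.- (ρ ℤ.+ Q₂ ℤ.* pos N) ℤ.+ pos 6 ℤ.* pos k
        ≡⟨ cong (λ n → (ρ ℤ.+ Q₁ ℤ.* n) ℤ.- (ρ ℤ.+ Q₂ ℤ.* n) ℤ.+ pos 6 ℤ.* pos k) +N≡ ⟩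
      (ρ ℤ.+ Q₁ ℤ.* (pos 6 ℤ.* pos L)) ℤ.- (ρ ℤ.+ Q₂ ℤ.* (pos 6 ℤ.* pos L)) ℤ.+ pos 6 ℤ.* pos k
        ≡⟨ solve 5 (λ r q₁ q₂ l k → (r :+ q₁ :* (con (pos 6) :* l)) :- (r :+ q₂ :* (con (pos 6) :* l)) :+ con (pos 6) :* k
                                  := con (pos 0) :+ (k :+ (q₁ :- q₂) :* l) :* con (pos 6)) refl ρ Q₁ Q₂ (pos L) (pos k) ⟩
      pos 0 ℤ.+ Q ℤ.* pos 6 ∎

any-allFin : ∀ {m} (p : Fin m → Bool) i → p i ≡ true → any p (allFin m) ≡ true
any-allFin p i pi = Equivalence.to T-≡ (Any.any⁺ p (Any.tabulate⁺ i (Equivalence.from T-≡ pi)))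

all-allFin : ∀ {m} (p : Fin m → Bool) → (∀ i → p i ≡ true) → all p (allFin m) ≡ true
all-allFin p all-p = Equivalence.to T-≡ (All.all⁻ p (All.tabulate⁺ (λ i → Equivalence.from T-≡ (all-p i))))

==-complete : ∀ {m} {i j : Fin m} → i ≡ j → (i == j) ≡ true
==-complete {i = i} {j} = ⌊⌋-true (i ≟F j)

==-sound : ∀ {m} {i j : Fin m} → (i == j) ≡ true → i ≡ j
==-sound {i = i} {j} = ⌊⌋-sound (i ≟F j)

==-≢ : ∀ {m} {i j : Fin m} → i ≢ j → (i == j) ≡ false
==-≢ i≢j = ¬-not (λ i==j → i≢j (==-sound i==j))

==-false : ∀ {m} {i j : Fin m} → (i == j) ≡ false → i ≢ j
==-false i==j i≡j = case trans (sym (==-complete i≡j)) i==j of λ ()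

∧-true : ∀ {a b} → a ∧ b ≡ true → a ≡ true × b ≡ true
∧-true {true} {true} _ = refl , refl

walk-snoc : ∀ {n} {R : Fin n → Fin n → Set} {x y z k} → Walk R x y k → R y z → Walk R x z (suc k)
walk-snoc here       r = step r here
walk-snoc (step r w) r' = step r (walk-snoc w r')

-- G-edges are edges of the virtual graph, so virtual distances grow by at
-- most one along them
vd-edge : ∀ {n} {G : Graph n} {s} (T : GST G s) (vd : Fin n → ℕ) →
          (∀ w → IsDist (VEdge T) s w (vd w)) → ∀ a b → Edge G a b → vd b ≤ suc (vd a)
vd-edge T vd isd a b ab = proj₂ (isd b) (suc (vd a)) (walk-snoc (proj₁ (isd a)) (inj₁ ab))

edge-sym : ∀ {n} (G : Graph n) a b → Edge G a b → Edge G b a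
edge-sym G a b ab = trans (adj-sym G b a) ab

three-levels : ∀ {d y} → d ≤ y → y ≤ suc (suc d) → y ≡ d ⊎ (y ≡ suc d ⊎ y ≡ suc (suc d))
three-levels {zero} {zero}                _ _ = inj₁ refl
three-levels {zero} {suc zero}            _ _ = inj₂ (inj₁ refl)
three-levels {zero} {suc (suc zero)}      _ _ = inj₂ (inj₂ refl)
three-levels {zero} {suc (suc (suc y))}   _ (s≤s (s≤s ()))
three-levels {suc d} (s≤s lo) (s≤s hi) = Sum.map (cong suc) (Sum.map (cong suc) (cong suc)) (three-levels lo hi)

nonzero-bound : ∀ {k L} → k < L → ∃ λ L' → L ≡ suc L'
nonzero-bound (s≤s _) = _ , refl

module Reception {n : ℕ} (G : Graph n) {s : Fin n} (T : GST G s) (vd : Fin n → ℕ) where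
  open Schedule G T vd

  sole-transmitter : ∀ t (cs : Fin n → Bool) u x →
    transmits t u (cs u) ≡ false → Edge G u x → transmits t x (cs x) ≡ true →
    (∀ w → w ≢ x → Edge G u w → transmits t w (cs w) ≡ false) →
    receivesFrom t cs u x ≡ true
  sole-transmitter t cs u x u-silent ux x-sends others-silent =
    cong₂ _∧_ (cong not u-silent) (cong₂ _∧_ ux (cong₂ _∧_ x-sends (all-allFin _ no-interference)))
    where
    no-interference : ∀ w → ((w == x) ∨ not (adj G u w) ∨ not (transmits t w (cs w))) ≡ true
    no-interference w with w == x in w==x | adj G u w in uw
    ... | true  | _     = refl
    ... | false | false = refl
    ... | false | true  = cong not (others-silent w (==-false w==x) uw)

module ScheduleAtTarget {n : ℕ} (G : Graph n) {s : Fin n} (T : GST G s) (vd : Fin n → ℕ)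
  (L' : ℕ) (L≡ : Schedule.L G T vd ≡ suc L') (d k t : ℕ) (k<L : k < suc L')
  (t≡ : t % (6 * suc L') ≡ (1 + 2 * d + 6 * k) % (6 * suc L')) where
  open Schedule G T vd
  open TargetRound L' t (1 + 2 * d) k t≡
  open ℕ-Solver using (solve; _:+_; _:*_; _:=_; con)

  no-deterministic : ∀ w → detTx t w ≡ false
  no-deterministic w rewrite L≡ = parity-clash L' t d (level T w + 3 * rank T w) target-mod-6

  random-at-d : ∀ w → vd w ≡ d → randRound t w ≡ true
  random-at-d w vw≡d rewrite vw≡d = congr?-complete 6 t (1 + 2 * d) target-mod-6

  random-off : ∀ w → vd w ≡ suc d ⊎ vd w ≡ suc (suc d) → randRound t w ≡ false
  random-off w (inj₁ vw≡) rewrite vw≡ =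
    subst (λ z → congr? 6 t z ≡ false) (solve 1 (λ d → con 1 :+ con 2 :* d :+ con 2 := con 1 :+ con 2 :* (con 1 :+ d)) refl d)
          (congr?-shift 6 t (1 + 2 * d) 2 target-mod-6 (toWitnessFalse {a? = 6 ∣? 2} _))
  random-off w (inj₂ vw≡) rewrite vw≡ =
    subst (λ z → congr? 6 t z ≡ false) (solve 1 (λ d → con 1 :+ con 2 :* d :+ con 4 := con 1 :+ con 2 :* (con 2 :+ d)) refl d)
          (congr?-shift 6 t (1 + 2 * d) 4 target-mod-6 (toWitnessFalse {a? = 6 ∣? 4} _))

  coin-at-d : ∀ w → vd w ≡ d → coinProb t w ≡ half^ k
  coin-at-d w vw≡d rewrite random-at-d w vw≡d | vw≡d | L≡ = cong half^ (target-exponent k<L)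

  transmits-at-d : ∀ w c → vd w ≡ d → transmits t w c ≡ c
  transmits-at-d w c vw≡d rewrite no-deterministic w | random-at-d w vw≡d = refl

  transmits-off : ∀ w c → vd w ≡ suc d ⊎ vd w ≡ suc (suc d) → transmits t w c ≡ false
  transmits-off w c far rewrite no-deterministic w | random-off w far = refl

module Window {n : ℕ} (G : Graph n) {s : Fin n} (T : GST G s) (vd : Fin n → ℕ)
  (isd : ∀ w → IsDist (VEdge T) s w (vd w))
  (u v : Fin n) (uv : Edge G u v) (v-closer : suc (vd v) ≡ vd u) (t₀ : ℕ) where
  open Schedule G T vd
  open Reception G T vd

  d : ℕ
  d = vd v

  sender : Fin n → Bool
  sender w = adj G u w ∧ ⌊ suc (vd w) ℕ.≟ vd u ⌋

  sender-sound : ∀ w → sender w ≡ true → Edge G u w × vd w ≡ d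
  sender-sound w h with ∧-true {adj G u w} h
  ... | uw , closer = uw , suc-injective (trans (⌊⌋-sound (suc (vd w) ℕ.≟ vd u) closer) (sym v-closer))

  sender-complete : ∀ w → Edge G u w → vd w ≡ d → sender w ≡ true
  sender-complete w uw vw≡d = cong₂ _∧_ uw (⌊⌋-true (suc (vd w) ℕ.≟ vd u) (trans (cong suc vw≡d) v-closer))

  neighbour-distance : ∀ w → Edge G u w → vd w ≡ d ⊎ (vd w ≡ suc d ⊎ vd w ≡ suc (suc d))
  neighbour-distance w uw = three-levels
    (≤-pred (subst (_≤ suc (vd w)) (sym v-closer) (vd-edge T vd isd w u (edge-sym G u w uw))))
    (subst (λ z → vd w ≤ suc z) (sym v-closer) (vd-edge T vd isd u w uw))

  -- there are c senders, 1 ≤ c < n (v is one, u is none); pick the bias 2^-k for them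
  c : ℕ
  c = count n sender

  -- kept abstract: the chosen round must not be unfolded during type checking
  abstract
    choice : ∃ λ k → k < L × half^ 3 ℚ.≤ oneHeadProb (half^ k) c
    choice = oneHead-choice n c (count-pos n sender v (sender-complete v uv refl))
                                (count-< n sender u (cong (_∧ ⌊ suc (vd u) ℕ.≟ vd u ⌋) (adj-irr G u)))

    k : ℕ
    k = proj₁ choice

    L' : ℕ
    L' = proj₁ (nonzero-bound (proj₁ (proj₂ choice)))

    L≡ : L ≡ suc L'
    L≡ = proj₂ (nonzero-bound (proj₁ (proj₂ choice)))

    slot : ∃ λ i → i < 6 * suc L' × (t₀ + i) % (6 * suc L') ≡ (1 + 2 * d + 6 * k) % (6 * suc L')
    slot = residue-in-window (6 * suc L') t₀ (1 + 2 * d + 6 * k)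

    i* : Fin R
    i* = fromℕ< (subst (λ l → proj₁ slot < 6 * l) (sym L≡) (proj₁ (proj₂ slot)))

    t-target : (t₀ + toℕ i*) % (6 * suc L') ≡ (1 + 2 * d + 6 * k) % (6 * suc L')
    t-target = trans (cong (λ z → (t₀ + z) % (6 * suc L')) (toℕ-fromℕ< _)) (proj₂ (proj₂ slot))

    k<L : k < suc L'
    k<L = subst (k <_) L≡ (proj₁ (proj₂ choice))

    bound : half^ 3 ℚ.≤ oneHeadProb (half^ k) c
    bound = proj₂ (proj₂ choice)

  t : ℕ
  t = t₀ + toℕ i*

  open ScheduleAtTarget G T vd L' L≡ d k t k<L t-target

  sole-sender-succeeds : ∀ ω x → sender x ≡ true → ω (combine i* x) ≡ true →
    (∀ w → sender w ≡ true → ω (combine i* w) ≡ true → w ≡ x) → Success u t₀ ω ≡ true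
  sole-sender-succeeds ω x x-sender x-heads unique =
    any-allFin (λ i → any (λ w → ⌊ suc (vd w) ℕ.≟ vd u ⌋ ∧ receivesFrom (t₀ + toℕ i) (λ y → ω (combine i y)) u w) (allFin n)) i*
      (any-allFin (λ w → ⌊ suc (vd w) ℕ.≟ vd u ⌋ ∧ receivesFrom t cs u w) x (cong₂ _∧_ (proj₂ (∧-true {adj G u x} x-sender)) received))
    where
    cs : Fin n → Bool
    cs w = ω (combine i* w)
    vx≡d : vd x ≡ d
    vx≡d = proj₂ (sender-sound x x-sender)
    others-silent : ∀ w → w ≢ x → Edge G u w → transmits t w (cs w) ≡ false
    others-silent w w≢x uw with neighbour-distance w uw
    ... | inj₂ far  = transmits-off w (cs w) far
    ... | inj₁ vw≡d with cs w in w-heads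
    ...   | false = transmits-at-d w false vw≡d
    ...   | true  = case w≢x (unique w (sender-complete w uw vw≡d) w-heads) of λ ()
    received : receivesFrom t cs u x ≡ true
    received = sole-transmitter t cs u x
      (transmits-off u (cs u) (inj₁ (sym v-closer)))
      (proj₁ (sender-sound x x-sender))
      (trans (transmits-at-d x (cs x) vx≡d) x-heads)
      others-silent

  selected : Fin (R * n) → Bool
  selected j = (proj₁ (remQuot {R} n j) == i*) ∧ sender (proj₂ (remQuot {R} n j))

  selected-combine : ∀ i x → selected (combine i x) ≡ (i == i*) ∧ sender x
  selected-combine i x = cong (λ (ix : Fin R × Fin n) → (proj₁ ix == i*) ∧ sender (proj₂ ix)) (remQuot-combine i x)

  count-selected : count (R * n) selected ≡ c
  count-selected = trans
    (count-block R n selected i* (λ i x i≢i* → trans (selected-combine i x) (cong (_∧ sender x) (==-≢ i≢i*))))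
    (count-cong n (λ x → trans (selected-combine i* x) (cong (_∧ sender x) (==-complete {i = i*} refl))))

  coinProbs : Fin (R * n) → ℚ
  coinProbs j = coinProb (t₀ + toℕ (proj₁ (remQuot {R} n j))) (proj₂ (remQuot {R} n j))

  coinProbs-prob : ∀ j → IsProb (coinProbs j)
  coinProbs-prob j = coin-prob (randRound (t₀ + toℕ (proj₁ (remQuot {R} n j))) (proj₂ (remQuot {R} n j)))
                               (expo (t₀ + toℕ (proj₁ (remQuot {R} n j))) (proj₂ (remQuot {R} n j)))

  selected-bias : ∀ j → selected j ≡ true → coinProbs j ≡ half^ k
  selected-bias j sel-j with ∧-true {proj₁ (remQuot {R} n j) == i*} sel-j
  ... | in-round , is-sender =
    trans (cong (λ i → coinProb (t₀ + toℕ i) (proj₂ (remQuot {R} n j))) (==-sound in-round))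
          (coin-at-d (proj₂ (remQuot {R} n j)) (proj₂ (sender-sound _ is-sender)))

  one-selected⇒success : ∀ ω → oneSelected (R * n) selected ω ≡ true → Success u t₀ ω ≡ true
  one-selected⇒success ω one
    with count-one (R * n) (λ j → selected j ∧ ω j) (≡ᵇ⇒≡ _ 1 (Equivalence.from T-≡ one))
  ... | j , sel∧heads , unique with ∧-true {selected j} sel∧heads
  ...   | sel-j , heads-j with ∧-true {proj₁ (remQuot {R} n j) == i*} sel-j
  ...     | in-round , is-sender = sole-sender-succeeds ω x is-sender x-heads x-unique
    where
    x : Fin n
    x = proj₂ (remQuot {R} n j)
    j≡ : combine i* x ≡ j
    j≡ = trans (cong (λ i → combine i x) (sym (==-sound in-round))) (combine-remQuot {R} n j)
    x-heads : ω (combine i* x) ≡ true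
    x-heads = trans (cong ω j≡) heads-j
    x-unique : ∀ w → sender w ≡ true → ω (combine i* w) ≡ true → w ≡ x
    x-unique w w-sender w-heads = combine-injectiveʳ i* w i* x (trans
      (unique (combine i* w) (cong₂ _∧_ (trans (selected-combine i* w) (cong₂ _∧_ (==-complete {i = i*} refl) w-sender)) w-heads))
      (sym j≡))

lemma9 : ∀ {n : ℕ} (G : Graph n) (s : Fin n) → Connected G → (T : GST G s) →
    (vd : Fin n → ℕ) → (∀ u → IsDist (VEdge T) s u (vd u)) →
    ∀ (u v : Fin n) → Edge G u v → suc (vd v) ≡ vd u →
    ∀ (t₀ : ℕ) → half^ 3 ℚ.≤ Schedule.successProb G T vd u t₀
lemma9 {n} G s _ T vd isd u v uv v-closer t₀ = begin
  half^ 3                                              ≤⟨ bound ⟩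
  oneHeadProb (half^ k) c                              ≡⟨ cong (oneHeadProb (half^ k)) (sym count-selected) ⟩
  oneHeadProb (half^ k) (count (R * n) selected)       ≡⟨ sym (proj₂ (Pr-count (R * n) coinProbs selected (half^ k) selected-bias)) ⟩
  Pr (R * n) coinProbs (oneSelected (R * n) selected)  ≤⟨ Pr-mono (R * n) coinProbs coinProbs-prob _ (Success u t₀) one-selected⇒success ⟩
  Schedule.successProb G T vd u t₀                     ∎
  where
  open Schedule G T vd using (R; Success)
  open Window G T vd isd u v uv v-closer t₀
  open ℚP.≤-Reasoning
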